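{- For each $k\in\{1,3\}$, the following rules are admissible in $\mathbf{C}_k$ (whenever their premises are derivable in $\mathbf{C}_k$, so is their conclusion): (IO-Wk) from $G\vdash(B,Y)$ infer $(A,X),G\vdash(B,Y)$; (IO-Ctr) from $(A,X),(A,X),G\vdash(B,Y)$ infer $(A,X),G\vdash(B,Y)$; (IO-Cut) from $G\vdash(C,Z)$ and $(C,Z),G'\vdash(B,Y)$ infer $G,G'\vdash(B,Y)$.
   Context: Formulas are classical propositional formulas; $\models$ is classical entailment. An LK sequent $\Gamma\Rightarrow\Delta$ is derivable in LK iff $\bigwedge\Gamma\models\bigvee\Delta$ (empty conjunction $=\top$, empty disjunction $=\bot$). An I/O pair is an ordered pair $(A,X)$ of formulas; an I/O sequent has the form $G\vdash(B,Y)$ with $G$ a finite multiset of pairs ($G,G'$ denotes multiset union). Rules: (IN) from $B\Rightarrow$ infer $G\vdash(B,Y)$; (OUT) from $\Rightarrow Y$ infer $G\vdash(B,Y)$; (E1) from the LK sequent $B\Rightarrow A$ and $G\vdash(B,Y\vee\neg X)$ infer $(A,X),G\vdash(B,Y)$; (E3) from the LK sequent $B\Rightarrow A$ and $G\vdash(B\wedge X,Y\vee\neg X)$ infer $(A,X),G\vdash(B,Y)$. $\mathbf{C}_1$ has rules IN, OUT, E1; $\mathbf{C}_3$ has rules IN, OUT, E3. An I/O sequent is derivable in a calculus if it is the root of a finite tree built with its rules in which every LK-sequent premise is derivable in LK. -}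

module Defs where

open import Data.Nat using (ℕ)
open import Data.Bool using (Bool; true; false; _∧_; _∨_; not)
open import Data.List using (List; []; _∷_)
open import Data.Product using (_×_; _,_)
open import Relation.Binary.PropositionalEquality using (_≡_)
open import Data.List.Relation.Binary.Permutation.Propositional using (_↭_)

data Fm : Set where
  atom : ℕ → Fm
  ⊤f ⊥f : Fm
  ¬f_ : Fm → Fm
  _∧f_ _∨f_ _⇒f_ : Fm → Fm → Fm

infixr 6 _∧f_
infixr 5 _∨f_
infixr 4 _⇒f_
infix 7 ¬f_

Valuation : Set
Valuation = ℕ → Bool

eval : Valuation → Fm → Bool
eval v (atom p) = v p
eval v ⊤f = true
eval v ⊥f = false
eval v (¬f A) = not (eval v A)
eval v (A ∧f B) = eval v A ∧ eval v B
eval v (A ∨f B) = eval v A ∨ eval v B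
eval v (A ⇒f B) = not (eval v A) ∨ eval v B

evalConj : Valuation → List Fm → Bool
evalConj v [] = true
evalConj v (A ∷ Γ) = eval v A ∧ evalConj v Γ

evalDisj : Valuation → List Fm → Bool
evalDisj v [] = false
evalDisj v (A ∷ Δ) = eval v A ∨ evalDisj v Δ

-- An LK sequent Γ ⇒ Δ is derivable iff ⋀Γ ⊨ ⋁Δ (as given in the context).
LK : List Fm → List Fm → Set
LK Γ Δ = ∀ (v : Valuation) → evalConj v Γ ≡ true → evalDisj v Δ ≡ true

-- I/O pairs; contexts are lists read up to permutation (multisets).
Pair : Set
Pair = Fm × Fm

data Calc : Set where
  C1 C3 : Calc

-- Derivability of the I/O sequent  G ⊢ (B , Y)  in calculus k.
-- The principal pair of E1/E3 may sit anywhere in the multiset: the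
-- conclusion context is any permutation of (A , X) ∷ G.
data _⊢_⟨_,_⟩ : Calc → List Pair → Fm → Fm → Set where
  IN  : ∀ {k G B Y} → LK (B ∷ []) [] → k ⊢ G ⟨ B , Y ⟩
  OUT : ∀ {k G B Y} → LK [] (Y ∷ []) → k ⊢ G ⟨ B , Y ⟩
  E1  : ∀ {G G' A X B Y} → G' ↭ ((A , X) ∷ G) →
        LK (B ∷ []) (A ∷ []) → C1 ⊢ G ⟨ B , Y ∨f ¬f X ⟩ → C1 ⊢ G' ⟨ B , Y ⟩
  E3  : ∀ {G G' A X B Y} → G' ↭ ((A , X) ∷ G) →
        LK (B ∷ []) (A ∷ []) → C3 ⊢ G ⟨ B ∧f X , Y ∨f ¬f X ⟩ → C3 ⊢ G' ⟨ B , Y ⟩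

-- Weakening is immediate since the principal pair of E1/E3 may sit anywhere in the
-- context.  Contraction rests on the invertibility of E1/E3 without their side
-- condition: a pair (A , X) can be dropped from the context at the price of
-- adding ¬X to the output, and then the duplicate ¬X is absorbed.  Cut permutes
-- upward in the right derivation until the cut pair (C , Z) is principal; there
-- the right premise carries Y ∨ ¬Z, and an induction on the left derivation of
-- (C , Z) replays its E-steps, ending either in IN (C, hence B, unsatisfiable)
-- or in OUT (Z valid, so ¬Z can be dropped).
module Submission where

open import Defs
open import Data.Bool using (true; false; not; _∧_; _∨_; _≤_; b≤b; f≤t)
open import Data.Bool.Properties
  using (≤-refl; ≤-trans; ≤-reflexive; ≤-minimum; ≤-maximum; ∧-identityʳ; ∨-identityʳ)
open import Data.List using (List; []; _∷_; _++_)
open import Data.List.Membership.Propositional.Properties using (∈-∃++)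
open import Data.List.Relation.Binary.Permutation.Propositional
  using (_↭_; refl; prep; swap; ↭-sym; ↭-trans)
open import Data.List.Relation.Binary.Permutation.Propositional.Properties
  using (∈-resp-↭; ++⁺ˡ; ++⁺ʳ; shift; drop-∷)
open import Data.List.Relation.Unary.Any using (here; there)
open import Data.Product using (_×_; _,_; ∃)
open import Data.Sum using (_⊎_; inj₁; inj₂)
open import Relation.Binary.PropositionalEquality using (_≡_; refl; sym; trans)

private
  variable
    k : Calc
    P Q : Pair
    Γ Δ G G' H : List Pair
    A B B' C X Y Y' Z : Fm

-- A record rather than LK (B ∷ []) (A ∷ []) itself, so that B and A can be
-- inferred: LK is not injective, which is also why LK-antiˡ and LK-monoʳ take
-- the other side of the sequent explicitly.
infix 3 _⊨_
record _⊨_ (B A : Fm) : Set where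
  constructor ⊨-intro
  field ⊨-elim : ∀ v → eval v B ≤ eval v A
open _⊨_

∧-lowerˡ : ∀ a b → a ∧ b ≤ a
∧-lowerˡ true b = ≤-maximum b
∧-lowerˡ false b = b≤b

∧-lowerʳ : ∀ a b → a ∧ b ≤ b
∧-lowerʳ true b = ≤-refl
∧-lowerʳ false b = ≤-minimum b

∧-greatest : ∀ {a b c} → c ≤ a → c ≤ b → c ≤ a ∧ b
∧-greatest {true} _ h = h
∧-greatest {false} h _ = h

∨-upperˡ : ∀ a b → a ≤ a ∨ b
∨-upperˡ true b = b≤b
∨-upperˡ false b = ≤-minimum b

∨-upperʳ : ∀ a b → b ≤ a ∨ b
∨-upperʳ true b = ≤-maximum b
∨-upperʳ false b = ≤-refl

∨-least : ∀ {a b c} → a ≤ c → b ≤ c → a ∨ b ≤ c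
∨-least {true} h _ = h
∨-least {false} _ h = h

∧-monoˡ-≤ : ∀ {a b c} → a ≤ b → a ∧ c ≤ b ∧ c
∧-monoˡ-≤ b≤b = ≤-refl
∧-monoˡ-≤ {c = c} f≤t = ≤-minimum c

∨-monoˡ-≤ : ∀ {a b c} → a ≤ b → a ∨ c ≤ b ∨ c
∨-monoˡ-≤ b≤b = ≤-refl
∨-monoˡ-≤ {c = c} f≤t = ≤-maximum c

≤-≡-true : ∀ {a b} → a ≤ b → a ≡ true → b ≡ true
≤-≡-true b≤b e = e
≤-≡-true f≤t _ = refl

≡-true-≤ : ∀ a b → (a ≡ true → b ≡ true) → a ≤ b
≡-true-≤ false b _ = ≤-minimum b
≡-true-≤ true true _ = b≤b
≡-true-≤ true false h with h refl
... | ()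

LK⇒⊨ : LK (B ∷ []) (A ∷ []) → B ⊨ A
LK⇒⊨ {B} {A} h = ⊨-intro λ v → ≡-true-≤ (eval v B) (eval v A) λ e →
  trans (sym (∨-identityʳ (eval v A))) (h v (trans (∧-identityʳ (eval v B)) e))

LK-antiˡ : ∀ Δ → B' ⊨ B → LK (B ∷ []) Δ → LK (B' ∷ []) Δ
LK-antiˡ Δ h d v e = d v (≤-≡-true (∧-monoˡ-≤ (⊨-elim h v)) e)

LK-monoʳ : ∀ Γ → Y ⊨ Y' → LK Γ (Y ∷ []) → LK Γ (Y' ∷ [])
LK-monoʳ Γ h d v e = ≤-≡-true (∨-monoˡ-≤ (⊨-elim h v)) (d v e)

-- Both sides agree definitionally: ⋀[] and ⋀[⊤f] both evaluate to true.
valid⇒⊨ : LK [] (Z ∷ []) → ⊤f ⊨ Z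
valid⇒⊨ = LK⇒⊨

⊨-refl : A ⊨ A
⊨-refl = ⊨-intro λ _ → ≤-refl

⊨-trans : A ⊨ B → B ⊨ C → A ⊨ C
⊨-trans f g = ⊨-intro λ v → ≤-trans (⊨-elim f v) (⊨-elim g v)

⊨-⊤f : B ⊨ ⊤f
⊨-⊤f {B} = ⊨-intro λ v → ≤-maximum (eval v B)

∧f-lowerˡ : B ∧f X ⊨ B
∧f-lowerˡ {B} {X} = ⊨-intro λ v → ∧-lowerˡ (eval v B) (eval v X)

∧f-lowerʳ : B ∧f X ⊨ X
∧f-lowerʳ {B} {X} = ⊨-intro λ v → ∧-lowerʳ (eval v B) (eval v X)

∧f-greatest : B ⊨ C → B ⊨ X → B ⊨ C ∧f X
∧f-greatest f g = ⊨-intro λ v → ∧-greatest (⊨-elim f v) (⊨-elim g v)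

∧f-monoˡ : B' ⊨ B → B' ∧f X ⊨ B ∧f X
∧f-monoˡ h = ⊨-intro λ v → ∧-monoˡ-≤ (⊨-elim h v)

∨f-upperˡ : Y ⊨ Y ∨f X
∨f-upperˡ {Y} {X} = ⊨-intro λ v → ∨-upperˡ (eval v Y) (eval v X)

∨f-upperʳ : X ⊨ Y ∨f X
∨f-upperʳ {X} {Y} = ⊨-intro λ v → ∨-upperʳ (eval v Y) (eval v X)

∨f-least : Y ⊨ C → X ⊨ C → Y ∨f X ⊨ C
∨f-least f g = ⊨-intro λ v → ∨-least (⊨-elim f v) (⊨-elim g v)

∨f-monoˡ : Y ⊨ Y' → Y ∨f X ⊨ Y' ∨f X
∨f-monoˡ h = ⊨-intro λ v → ∨-monoˡ-≤ (⊨-elim h v)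

∨f-idemʳ : (Y ∨f X) ∨f X ⊨ Y ∨f X
∨f-idemʳ = ∨f-least ⊨-refl ∨f-upperʳ

∨f-swapʳ : (Y ∨f X) ∨f Z ⊨ (Y ∨f Z) ∨f X
∨f-swapʳ = ∨f-least (∨f-least (⊨-trans ∨f-upperˡ ∨f-upperˡ) ∨f-upperʳ)
                    (⊨-trans ∨f-upperʳ ∨f-upperˡ)

¬f-valid : ⊤f ⊨ Z → Y ∨f ¬f Z ⊨ Y
¬f-valid {Z} {Y} t = ⊨-intro λ v → drop (⊨-elim t v)
  where
  drop : ∀ {y z} → true ≤ z → y ∨ not z ≤ y
  drop {y} b≤b = ≤-reflexive (∨-identityʳ y)

-- One E-step of the left premise of a cut turns its output Z into Z ∨ ¬X (and,
-- in C3, its input C into C ∧ X); the right premise of the cut survives this.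

∨f-¬f-step : Y ∨f ¬f Z ⊨ (Y ∨f ¬f X) ∨f ¬f (Z ∨f ¬f X)
∨f-¬f-step {Y} {Z} {X} = ⊨-intro λ v → step (eval v Y) (eval v Z) (eval v X)
  where
  step : ∀ y z x → y ∨ not z ≤ (y ∨ not x) ∨ not (z ∨ not x)
  step true z x = b≤b
  step false z false = ≤-maximum (not z)
  step false true true = b≤b
  step false false true = b≤b

∧f-step : (B ∧f X) ∧f (Z ∨f ¬f X) ⊨ B ∧f Z
∧f-step {B} {X} {Z} = ⊨-intro λ v → step (eval v B) (eval v X) (eval v Z)
  where
  step : ∀ b x z → (b ∧ x) ∧ (z ∨ not x) ≤ b ∧ z
  step false x z = b≤b
  step true false z = ≤-minimum z
  step true true z = ≤-reflexive (∨-identityʳ z)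

∷↭∷-inv : P ∷ Γ ↭ Q ∷ Δ →
  (P ≡ Q × Γ ↭ Δ) ⊎ ∃ λ Θ → Γ ↭ Q ∷ Θ × Δ ↭ P ∷ Θ
∷↭∷-inv {P = P} {Q = Q} {Δ = Δ} p with ∈-resp-↭ (↭-sym p) (here refl)
... | here refl = inj₁ (refl , drop-∷ p)
... | there q with ∈-∃++ q
... | xs , ys , refl = inj₂ (xs ++ ys , shift Q xs ys , ↭-sym (drop-∷ Q∷P∷Θ↭Q∷Δ))
  where
  Q∷P∷Θ↭Q∷Δ : Q ∷ P ∷ xs ++ ys ↭ Q ∷ Δ
  Q∷P∷Θ↭Q∷Δ = ↭-trans (swap Q P refl) (↭-trans (prep P (↭-sym (shift Q xs ys))) p)

∷↭∷∷-inv : Q ∷ Γ ↭ P ∷ P ∷ H →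
  (Q ≡ P × Γ ↭ P ∷ H) ⊎ ∃ λ Θ → Γ ↭ P ∷ P ∷ Θ × H ↭ Q ∷ Θ
∷↭∷∷-inv {P = P} p with ∷↭∷-inv p
... | inj₁ q = inj₁ q
... | inj₂ (Δ , q , r) with ∷↭∷-inv r
...   | inj₁ (refl , s) = inj₁ (refl , ↭-trans q (prep P (↭-sym s)))
...   | inj₂ (Θ , s , t) = inj₂ (Θ , ↭-trans q (prep P t) , s)

⊢-resp-↭ : G ↭ G' → k ⊢ G ⟨ B , Y ⟩ → k ⊢ G' ⟨ B , Y ⟩
⊢-resp-↭ q (IN u) = IN u
⊢-resp-↭ q (OUT t) = OUT t
⊢-resp-↭ q (E1 p l d) = E1 (↭-trans (↭-sym q) p) l d
⊢-resp-↭ q (E3 p l d) = E3 (↭-trans (↭-sym q) p) l d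

⊢-mono : B' ⊨ B → Y ⊨ Y' → k ⊢ G ⟨ B , Y ⟩ → k ⊢ G ⟨ B' , Y' ⟩
⊢-mono hb hy (IN u) = IN (LK-antiˡ [] hb u)
⊢-mono hb hy (OUT t) = OUT (LK-monoʳ [] hy t)
⊢-mono hb hy (E1 {A = A} p l d) =
  E1 p (LK-antiˡ (A ∷ []) hb l) (⊢-mono hb (∨f-monoˡ hy) d)
⊢-mono hb hy (E3 {A = A} p l d) =
  E3 p (LK-antiˡ (A ∷ []) hb l) (⊢-mono (∧f-monoˡ hb) (∨f-monoˡ hy) d)

weaken : ∀ P → k ⊢ G ⟨ B , Y ⟩ → k ⊢ P ∷ G ⟨ B , Y ⟩
weaken P (IN u) = IN u
weaken P (OUT t) = OUT t
weaken P (E1 p l d) = E1 (↭-trans (prep P p) (swap P _ refl)) l (weaken P d)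
weaken P (E3 p l d) = E3 (↭-trans (prep P p) (swap P _ refl)) l (weaken P d)

weaken-++ : ∀ G → k ⊢ G' ⟨ B , Y ⟩ → k ⊢ G ++ G' ⟨ B , Y ⟩
weaken-++ [] d = d
weaken-++ (P ∷ G) d = weaken P (weaken-++ G d)

E1-inv : C1 ⊢ Γ ⟨ B , Y ⟩ → Γ ↭ (A , X) ∷ Δ → C1 ⊢ Δ ⟨ B , Y ∨f ¬f X ⟩
E1-inv (IN u) q = IN u
E1-inv {Y = Y} {X = X} (OUT t) q =
  OUT (LK-monoʳ [] (∨f-upperˡ {Y = Y} {X = ¬f X}) t)
E1-inv (E1 p l d) q with ∷↭∷-inv (↭-trans (↭-sym p) q)
... | inj₁ (refl , r) = ⊢-resp-↭ r d
... | inj₂ (Θ , r , s) = E1 s l (⊢-mono ⊨-refl ∨f-swapʳ (E1-inv d r))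

E3-inv : B ⊨ X → C3 ⊢ Γ ⟨ B , Y ⟩ → Γ ↭ (A , X) ∷ Δ → C3 ⊢ Δ ⟨ B , Y ∨f ¬f X ⟩
E3-inv hx (IN u) q = IN u
E3-inv {X = X} {Y = Y} hx (OUT t) q =
  OUT (LK-monoʳ [] (∨f-upperˡ {Y = Y} {X = ¬f X}) t)
E3-inv hx (E3 p l d) q with ∷↭∷-inv (↭-trans (↭-sym p) q)
... | inj₁ (refl , r) = ⊢-mono (∧f-greatest ⊨-refl hx) ⊨-refl (⊢-resp-↭ r d)
... | inj₂ (Θ , r , s) =
  E3 s l (⊢-mono ⊨-refl ∨f-swapʳ (E3-inv (⊨-trans ∧f-lowerˡ hx) d r))

contract : k ⊢ Γ ⟨ B , Y ⟩ → Γ ↭ P ∷ P ∷ H → k ⊢ P ∷ H ⟨ B , Y ⟩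
contract (IN u) q = IN u
contract (OUT t) q = OUT t
contract {P = P} (E1 p l d) q with ∷↭∷∷-inv (↭-trans (↭-sym p) q)
... | inj₁ (refl , r) = E1 refl l (⊢-mono ⊨-refl ∨f-idemʳ (E1-inv d r))
... | inj₂ (Θ , r , s) = E1 (↭-trans (prep P s) (swap P _ refl)) l (contract d r)
contract {P = P} (E3 p l d) q with ∷↭∷∷-inv (↭-trans (↭-sym p) q)
... | inj₁ (refl , r) = E3 refl l (⊢-mono ⊨-refl ∨f-idemʳ (E3-inv ∧f-lowerʳ d r))
... | inj₂ (Θ , r , s) = E3 (↭-trans (prep P s) (swap P _ refl)) l (contract d r)

principal-cut₁ : B ⊨ C → C1 ⊢ G ⟨ C , Z ⟩ → C1 ⊢ G' ⟨ B , Y ∨f ¬f Z ⟩ →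
  C1 ⊢ G ++ G' ⟨ B , Y ⟩
principal-cut₁ hb (IN u) d = IN (LK-antiˡ [] hb u)
principal-cut₁ {G = G} hb (OUT t) d =
  weaken-++ G (⊢-mono ⊨-refl (¬f-valid (valid⇒⊨ t)) d)
principal-cut₁ {G' = G'} hb (E1 {A = A} p l e) d =
  E1 (++⁺ʳ G' p) (LK-antiˡ (A ∷ []) hb l)
     (principal-cut₁ hb e (⊢-mono ⊨-refl ∨f-¬f-step d))

principal-cut₃ : B ⊨ C → C3 ⊢ G ⟨ C , Z ⟩ → C3 ⊢ G' ⟨ B ∧f Z , Y ∨f ¬f Z ⟩ →
  C3 ⊢ G ++ G' ⟨ B , Y ⟩
principal-cut₃ hb (IN u) d = IN (LK-antiˡ [] hb u)
principal-cut₃ {G = G} {Z = Z} hb (OUT t) d =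
  weaken-++ G (⊢-mono (∧f-greatest ⊨-refl (⊨-trans ⊨-⊤f ⊨Z)) (¬f-valid ⊨Z) d)
  where
  ⊨Z : ⊤f ⊨ Z
  ⊨Z = valid⇒⊨ t
principal-cut₃ {G' = G'} hb (E3 {A = A} p l e) d =
  E3 (++⁺ʳ G' p) (LK-antiˡ (A ∷ []) hb l)
     (principal-cut₃ (∧f-monoˡ hb) e (⊢-mono ∧f-step ∨f-¬f-step d))

cut : k ⊢ G ⟨ C , Z ⟩ → k ⊢ Γ ⟨ B , Y ⟩ → Γ ↭ (C , Z) ∷ G' → k ⊢ G ++ G' ⟨ B , Y ⟩
cut dC (IN u) q = IN u
cut dC (OUT t) q = OUT t
cut {G = G} dC (E1 p l d) q with ∷↭∷-inv (↭-trans (↭-sym p) q)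
... | inj₁ (refl , r) = principal-cut₁ (LK⇒⊨ l) dC (⊢-resp-↭ r d)
... | inj₂ (Θ , r , s) = E1 (↭-trans (++⁺ˡ G s) (shift _ G Θ)) l (cut dC d r)
cut {G = G} dC (E3 p l d) q with ∷↭∷-inv (↭-trans (↭-sym p) q)
... | inj₁ (refl , r) = principal-cut₃ (LK⇒⊨ l) dC (⊢-resp-↭ r d)
... | inj₂ (Θ , r , s) = E3 (↭-trans (++⁺ˡ G s) (shift _ G Θ)) l (cut dC d r)

lemma12 : (k : Calc) →
    (∀ (G : List Pair) (A X B Y : Fm) →
       k ⊢ G ⟨ B , Y ⟩ → k ⊢ ((A , X) ∷ G) ⟨ B , Y ⟩)
    ×
    (∀ (G : List Pair) (A X B Y : Fm) →
       k ⊢ ((A , X) ∷ (A , X) ∷ G) ⟨ B , Y ⟩ → k ⊢ ((A , X) ∷ G) ⟨ B , Y ⟩)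
    ×
    (∀ (G G' : List Pair) (C Z B Y : Fm) →
       k ⊢ G ⟨ C , Z ⟩ → k ⊢ ((C , Z) ∷ G') ⟨ B , Y ⟩ → k ⊢ (G ++ G') ⟨ B , Y ⟩)
lemma12 k =
  (λ G A X B Y → weaken (A , X)) ,
  (λ G A X B Y d → contract d refl) ,
  (λ G G' C Z B Y dC d → cut dC d refl)
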